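{- Let $t\geq 2$ be an integer and let $G$ be a graph admitting a proper $t$-coloring. Then for every integer $t'$ with $1\leq t'\leq t$ there exists a (not necessarily proper) $t'$-coloring of the vertices of $G$ for which the number of monochromatic edges of $G$ is at most $|E(G)|\cdot\frac{2(t-t')}{tt'}$.
   Context: All graphs are finite and simple. A (not necessarily proper) $t'$-coloring of $G$ is any map $V(G)\to\{1,\dots,t'\}$; a proper $t$-coloring is a map $V(G)\to\{1,\dots,t\}$ giving distinct colors to the endpoints of every edge. An edge is monochromatic if its two endpoints have the same color. -}

module Defs where

open import Data.Nat using (ℕ; zero; suc; _+_; _*_; _<_)
open import Data.Bool using (Bool; true; false; _∧_; if_then_else_)
open import Data.Fin using (Fin; toℕ; _≟_)
open import Data.List using (List; allFin; filter; length; concatMap; map)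
open import Data.Product using (_×_; _,_; proj₁; proj₂)
open import Relation.Nullary using (¬_; does)
open import Relation.Binary.PropositionalEquality using (_≡_)

record Graph (n : ℕ) : Set where
  field
    adj   : Fin n → Fin n → Bool
    sym   : ∀ i j → adj i j ≡ adj j i
    irrfl : ∀ i → adj i i ≡ false
open Graph public

-- All ordered pairs (i , j) of vertices with toℕ i < toℕ j, i.e. the
-- unordered pairs of distinct vertices, each listed once.
pairs : (n : ℕ) → List (Fin n × Fin n)
pairs n = concatMap (λ i → map (i ,_) (filter (λ j → toℕ i Data.Nat.<? toℕ j) (allFin n))) (allFin n)

edges : ∀ {n} → Graph n → List (Fin n × Fin n)
edges {n} G = filter (λ p → adj G (proj₁ p) (proj₂ p) Data.Bool.≟ true) (pairs n)

numEdges : ∀ {n} → Graph n → ℕ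
numEdges G = length (edges G)

Coloring : ℕ → ℕ → Set
Coloring n k = Fin n → Fin k

IsProper : ∀ {n k} → Graph n → Coloring n k → Set
IsProper G c = ∀ i j → adj G i j ≡ true → ¬ (c i ≡ c j)

numMono : ∀ {n k} → Graph n → Coloring n k → ℕ
numMono G c = length (filter (λ p → c (proj₁ p) ≟ c (proj₂ p)) (edges G))

-- Start from the proper t-colouring, which has no monochromatic edge, and
-- merge two colour classes at a time. With k colours, the class a of least
-- degree has at most 2|E|/k edge ends, and among the other k − 1 classes
-- some b receives at most 1/(k − 1) of the edges leaving a; merging a and b
-- creates at most 2|E|/(k(k − 1)) new monochromatic edges. Since
-- 2(t − k)/(tk) + 2/(k(k − 1)) = 2(t − k + 1)/(t(k − 1)), the bound
-- M ≤ |E|·2(t − k)/(tk) is preserved from k = t down to k = t′.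
module Submission where

open import Data.Bool.Base using (true; if_then_else_)
open import Data.Bool.Properties using () renaming (_≟_ to _≟ᵇ_)
open import Data.Empty using (⊥-elim)
open import Data.Fin.Base using (Fin; zero; suc; punchIn; punchOut)
open import Data.Fin.Properties using (_≟_; punchInᵢ≢i; punchOut-injective)
open import Data.List.Base using (List; []; _∷_; length; filter; lookup)
open import Data.List.Membership.Propositional.Properties using (∈-filter⁻)
open import Data.List.Properties using (filter-none)
import Data.List.Relation.Unary.All as All
open import Data.Nat.Base using (ℕ; zero; suc; _+_; _*_; _∸_; _≤_; z≤n)
open import Data.Nat.Properties hiding (_≟_)
open import Data.Nat.Tactic.RingSolver using (solve-∀)
open import Data.Product.Base using (Σ; ∃; ∃₂; _×_; _,_; proj₁; proj₂)
open import Data.Sum.Base using (_⊎_; inj₁; inj₂)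
open import Function.Base using (_∘_)
open import Relation.Binary.PropositionalEquality
open import Relation.Nullary using (Dec; yes; no; does)
open import Relation.Unary using (Decidable)

open import Defs hiding (sym)
open import Algebra.Properties.Semiring.Sum +-*-semiring

𝟙 : {P : Set} → Dec P → ℕ
𝟙 P? = if does P? then 1 else 0

𝟙-yes : {P : Set} (P? : Dec P) → P → 𝟙 P? ≡ 1
𝟙-yes (yes _) _ = refl
𝟙-yes (no ¬p) p = ⊥-elim (¬p p)

length-filter≡∑𝟙 : {A : Set} {P : A → Set} (P? : Decidable P) (xs : List A) →
                   length (filter P? xs) ≡ ∑[ i < length xs ] 𝟙 (P? (lookup xs i))
length-filter≡∑𝟙 P? [] = refl
length-filter≡∑𝟙 P? (x ∷ xs) with P? x
... | yes _ = cong suc (length-filter≡∑𝟙 P? xs)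
... | no _ = length-filter≡∑𝟙 P? xs

∑-const : ∀ n x → ∑[ i < n ] x ≡ n * x
∑-const zero x = refl
∑-const (suc n) x = cong (x +_) (∑-const n x)

∑-mono-≤ : ∀ {n} {f g : Fin n → ℕ} → (∀ i → f i ≤ g i) → ∑[ i < n ] f i ≤ ∑[ i < n ] g i
∑-mono-≤ {zero} _ = z≤n
∑-mono-≤ {suc n} f≤g = +-mono-≤ (f≤g zero) (∑-mono-≤ (f≤g ∘ suc))

∑-𝟙-≟ : ∀ {n} (x : Fin n) → ∑[ i < n ] 𝟙 (x ≟ i) ≡ 1
∑-𝟙-≟ {suc n} zero = cong suc (sum-replicate-zero n)
∑-𝟙-≟ (suc x) = ∑-𝟙-≟ x

argmin : ∀ {n} (f : Fin (suc n) → ℕ) → ∃ λ i → ∀ j → f i ≤ f j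
argmin {zero} f = zero , λ { zero → ≤-refl }
argmin {suc n} f with argmin (f ∘ suc)
... | i , fi≤ with f zero ≤? f (suc i)
...   | yes f0≤fi = zero , λ { zero → ≤-refl ; (suc j) → ≤-trans f0≤fi (fi≤ j) }
...   | no f0≰fi = suc i , λ { zero → <⇒≤ (≰⇒> f0≰fi) ; (suc j) → fi≤ j }

∃-*≤∑ : ∀ {n} (f : Fin (suc n) → ℕ) → ∃ λ i → f i * suc n ≤ ∑[ j < suc n ] f j
∃-*≤∑ {n} f with argmin f
... | i , minimal = i , (begin
  f i * suc n            ≡⟨ *-comm (f i) (suc n) ⟩
  suc n * f i            ≡⟨ ∑-const (suc n) (f i) ⟨
  ∑[ j < suc n ] f i     ≤⟨ ∑-mono-≤ minimal ⟩
  ∑[ j < suc n ] f j     ∎)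
  where open ≤-Reasoning

-- For an edge with end colours x and y: how many ends are coloured a, and
-- whether the edge runs between the colours a and b (counted twice if a = b).
ends : ∀ {k} → Fin k → Fin k → Fin k → ℕ
ends x y a = 𝟙 (x ≟ a) + 𝟙 (y ≟ a)

joins : ∀ {k} → Fin k → Fin k → Fin k → Fin k → ℕ
joins x y a b = 𝟙 (x ≟ a) * 𝟙 (y ≟ b) + 𝟙 (x ≟ b) * 𝟙 (y ≟ a)

∑-ends : ∀ {k} (x y : Fin k) → ∑[ a < k ] ends x y a ≡ 2
∑-ends x y = trans (∑-distrib-+ (λ a → 𝟙 (x ≟ a)) (λ a → 𝟙 (y ≟ a))) (cong₂ _+_ (∑-𝟙-≟ x) (∑-𝟙-≟ y))

∑-joins : ∀ {k} (x y a : Fin k) → ∑[ b < k ] joins x y a b ≡ ends x y a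
∑-joins {k} x y a = begin
  ∑[ b < k ] joins x y a b                                   ≡⟨ ∑-distrib-+ (λ b → 𝟙 (x ≟ a) * 𝟙 (y ≟ b))
                                                                          (λ b → 𝟙 (x ≟ b) * 𝟙 (y ≟ a)) ⟩
  ∑[ b < k ] (𝟙 (x ≟ a) * 𝟙 (y ≟ b)) +
    ∑[ b < k ] (𝟙 (x ≟ b) * 𝟙 (y ≟ a))                       ≡⟨ cong₂ _+_ (*-distribˡ-sum (𝟙 (x ≟ a)) (λ b → 𝟙 (y ≟ b)))
                                                                          (*-distribʳ-sum (𝟙 (y ≟ a)) (λ b → 𝟙 (x ≟ b))) ⟨
  𝟙 (x ≟ a) * ∑[ b < k ] 𝟙 (y ≟ b) +
    ∑[ b < k ] 𝟙 (x ≟ b) * 𝟙 (y ≟ a)                         ≡⟨ cong₂ _+_ (cong (𝟙 (x ≟ a) *_) (∑-𝟙-≟ y))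
                                                                          (cong (_* 𝟙 (y ≟ a)) (∑-𝟙-≟ x)) ⟩
  𝟙 (x ≟ a) * 1 + 1 * 𝟙 (y ≟ a)                              ≡⟨ cong₂ _+_ (*-identityʳ (𝟙 (x ≟ a))) (*-identityˡ (𝟙 (y ≟ a))) ⟩
  ends x y a                                                 ∎
  where open ≡-Reasoning

MergesOnly : {A B : Set} → (A → B) → A → A → Set
MergesOnly f a b = ∀ {x y} → f x ≡ f y → x ≡ y ⊎ (x ≡ a × y ≡ b) ⊎ (x ≡ b × y ≡ a)

𝟙-≟-∘-≤ : ∀ {k k′} {f : Fin k → Fin k′} {a b} → MergesOnly f a b →
              ∀ x y → 𝟙 (f x ≟ f y) ≤ 𝟙 (x ≟ y) + joins x y a b
𝟙-≟-∘-≤ {f = f} {a} {b} merges x y with f x ≟ f y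
... | no _ = z≤n
... | yes fx≡fy with merges fx≡fy
...   | inj₁ x≡y = ≤-trans (≤-reflexive (sym (𝟙-yes (x ≟ y) x≡y))) (m≤m+n _ (joins x y a b))
...   | inj₂ (inj₁ (x≡a , y≡b)) =
        ≤-trans (≤-reflexive (sym (cong₂ _*_ (𝟙-yes (x ≟ a) x≡a) (𝟙-yes (y ≟ b) y≡b))))
                (≤-trans (m≤m+n _ (𝟙 (x ≟ b) * 𝟙 (y ≟ a))) (m≤n+m (joins x y a b) (𝟙 (x ≟ y))))
...   | inj₂ (inj₂ (x≡b , y≡a)) =
        ≤-trans (≤-reflexive (sym (cong₂ _*_ (𝟙-yes (x ≟ b) x≡b) (𝟙-yes (y ≟ a) y≡a))))
                (≤-trans (m≤n+m _ (𝟙 (x ≟ a) * 𝟙 (y ≟ b))) (m≤n+m (joins x y a b) (𝟙 (x ≟ y))))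

merge : ∀ {k} (a b : Fin (suc k)) → b ≢ a → Fin (suc k) → Fin k
merge a b b≢a w with w ≟ b
... | yes _ = punchOut b≢a
... | no w≢b = punchOut (w≢b ∘ sym)

merge-mergesOnly : ∀ {k} (a b : Fin (suc k)) (b≢a : b ≢ a) → MergesOnly (merge a b b≢a) a b
merge-mergesOnly a b b≢a {x} {y} eq with x ≟ b | y ≟ b
... | yes x≡b | yes y≡b = inj₁ (trans x≡b (sym y≡b))
... | yes x≡b | no _    = inj₂ (inj₂ (x≡b , sym (punchOut-injective b≢a _ eq)))
... | no _    | yes y≡b = inj₂ (inj₁ (sym (punchOut-injective b≢a _ (sym eq)) , y≡b))
... | no x≢b  | no y≢b  = inj₁ (punchOut-injective (x≢b ∘ sym) (y≢b ∘ sym) eq)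

module _ {V : Set} {m : ℕ} (edge : Fin m → V × V) where

  private
    src tgt : Fin m → V
    src = proj₁ ∘ edge
    tgt = proj₂ ∘ edge

  monochromatic : ∀ {k} → (V → Fin k) → ℕ
  monochromatic c = ∑[ e < m ] 𝟙 (c (src e) ≟ c (tgt e))

  degree : ∀ {k} → (V → Fin k) → Fin k → ℕ
  degree c a = ∑[ e < m ] ends (c (src e)) (c (tgt e)) a

  between : ∀ {k} → (V → Fin k) → Fin k → Fin k → ℕ
  between c a b = ∑[ e < m ] joins (c (src e)) (c (tgt e)) a b

  ∑-degree : ∀ {k} (c : V → Fin k) → ∑[ a < k ] degree c a ≡ 2 * m
  ∑-degree {k} c = begin
    ∑[ a < k ] ∑[ e < m ] ends (c (src e)) (c (tgt e)) a ≡⟨ ∑-comm (λ a e → ends (c (src e)) (c (tgt e)) a) ⟩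
    ∑[ e < m ] ∑[ a < k ] ends (c (src e)) (c (tgt e)) a ≡⟨ sum-cong-≗ (λ e → ∑-ends (c (src e)) (c (tgt e))) ⟩
    ∑[ e < m ] 2                                          ≡⟨ ∑-const m 2 ⟩
    m * 2                                                 ≡⟨ *-comm m 2 ⟩
    2 * m                                                 ∎
    where open ≡-Reasoning

  ∑-between : ∀ {k} (c : V → Fin k) a → ∑[ b < k ] between c a b ≡ degree c a
  ∑-between {k} c a = trans (∑-comm (λ b e → joins (c (src e)) (c (tgt e)) a b))
                            (sum-cong-≗ (λ e → ∑-joins (c (src e)) (c (tgt e)) a))

  monochromatic-∘-≤ : ∀ {k k′} (c : V → Fin k) {f : Fin k → Fin k′} {a b} → MergesOnly f a b →
                      monochromatic (f ∘ c) ≤ monochromatic c + between c a b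
  monochromatic-∘-≤ c {f} {a} {b} merges = begin
    monochromatic (f ∘ c)                              ≤⟨ ∑-mono-≤ (λ e → 𝟙-≟-∘-≤ merges (x e) (y e)) ⟩
    ∑[ e < m ] (𝟙 (x e ≟ y e) + joins (x e) (y e) a b) ≡⟨ ∑-distrib-+ _ (λ e → joins (x e) (y e) a b) ⟩
    monochromatic c + between c a b                    ∎
    where
    open ≤-Reasoning
    x y : Fin m → Fin _
    x = c ∘ src
    y = c ∘ tgt

  merge-cheapest : ∀ {k} (c : V → Fin (suc (suc k))) →
                   ∃₂ λ (c′ : V → Fin (suc k)) cost →
                     monochromatic c′ ≤ monochromatic c + cost × cost * (suc (suc k) * suc k) ≤ 2 * m
  merge-cheapest {k} c with ∃-*≤∑ (degree c)
  ... | a , degree-a with ∃-*≤∑ (between c a ∘ punchIn a)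
  ...   | j , between-a-b = merge a b b≢a ∘ c , between c a b
                          , monochromatic-∘-≤ c (merge-mergesOnly a b b≢a) , cost-bound
    where
    open ≤-Reasoning
    b : Fin (suc (suc k))
    b = punchIn a j
    b≢a : b ≢ a
    b≢a = punchInᵢ≢i a j
    between≤degree : between c a b * suc k ≤ degree c a
    between≤degree = begin
      between c a b * suc k                                    ≤⟨ between-a-b ⟩
      ∑[ i < suc k ] between c a (punchIn a i)                 ≤⟨ m≤n+m _ (between c a a) ⟩
      between c a a + ∑[ i < suc k ] between c a (punchIn a i) ≡⟨ sum-remove (between c a) ⟨
      ∑[ i < suc (suc k) ] between c a i                       ≡⟨ ∑-between c a ⟩
      degree c a                                               ∎
    cost-bound : between c a b * (suc (suc k) * suc k) ≤ 2 * m
    cost-bound = begin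
      between c a b * (suc (suc k) * suc k) ≡⟨ reassoc (between c a b) (suc (suc k)) (suc k) ⟩
      between c a b * suc k * suc (suc k)   ≤⟨ *-monoˡ-≤ (suc (suc k)) between≤degree ⟩
      degree c a * suc (suc k)              ≤⟨ degree-a ⟩
      ∑[ i < suc (suc k) ] degree c i       ≡⟨ ∑-degree c ⟩
      2 * m                                 ∎
      where
      reassoc : ∀ x y z → x * (y * z) ≡ x * z * y
      reassoc = solve-∀

-- The invariant M ≤ E · 2(t − k)/(t k), cleared of denominators, survives
-- going from k = j + 1 to k = j at the price e ≤ 2E/((j + 1) j).
bound-step : ∀ t j {M e E} → suc j ≤ t →
             M * (t * suc j) ≤ E * (2 * (t ∸ suc j)) → e * (suc j * j) ≤ 2 * E →
             (M + e) * (t * j) ≤ E * (2 * (t ∸ j))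
bound-step t j {M} {e} {E} j<t M-bound e-bound with m≤n⇒∃[o]m+o≡n j<t
... | r , refl = *-cancelʳ-≤ _ _ (suc j) (begin
  (M + e) * (T * j) * suc j                   ≡⟨ expand M e T j ⟩
  M * (T * suc j) * j + e * (suc j * j) * T   ≤⟨ +-mono-≤ (*-monoˡ-≤ j M-bound′) (*-monoˡ-≤ T e-bound) ⟩
  E * (2 * r) * j + 2 * E * T                 ≡⟨ collect E r j ⟩
  E * (2 * suc r) * suc j                     ≡⟨ cong (λ d → E * (2 * d) * suc j) T∸j ⟨
  E * (2 * (T ∸ j)) * suc j                   ∎)
  where
  open ≤-Reasoning
  T : ℕ
  T = suc j + r
  T∸j : T ∸ j ≡ suc r
  T∸j = trans (cong (_∸ j) (sym (+-suc j r))) (m+n∸m≡n j (suc r))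
  M-bound′ : M * (T * suc j) ≤ E * (2 * r)
  M-bound′ = subst (λ d → M * (T * suc j) ≤ E * (2 * d)) (m+n∸m≡n (suc j) r) M-bound
  expand : ∀ M e T j → (M + e) * (T * j) * suc j ≡ M * (T * suc j) * j + e * (suc j * j) * T
  expand = solve-∀
  collect : ∀ E r j → E * (2 * r) * j + 2 * E * (suc j + r) ≡ E * (2 * suc r) * suc j
  collect = solve-∀

module _ {V : Set} {m : ℕ} (edge : Fin m → V × V) (t : ℕ) where

  BoundedColouring : ℕ → Set
  BoundedColouring k = Σ (V → Fin k) λ c → monochromatic edge c * (t * k) ≤ m * (2 * (t ∸ k))

  boundedColouring-pred : ∀ {k} → 1 ≤ k → suc k ≤ t → BoundedColouring (suc k) → BoundedColouring k
  boundedColouring-pred {suc k} _ k<t (c , bound) =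
    let c′ , cost , c′≤c+cost , cost-bound = merge-cheapest edge c in
    c′ , ≤-trans (*-monoˡ-≤ (t * suc k) c′≤c+cost)
                 (bound-step t (suc k) {monochromatic edge c} {cost} {m} k<t bound cost-bound)

  boundedColouring-descend : ∀ d {k} → 1 ≤ k → d + k ≤ t → BoundedColouring (d + k) → BoundedColouring k
  boundedColouring-descend zero _ _ c = c
  boundedColouring-descend (suc d) {k} 1≤k d+k<t c =
    boundedColouring-descend d 1≤k (<⇒≤ d+k<t)
      (boundedColouring-pred {d + k} (≤-trans 1≤k (m≤n+m k d)) d+k<t c)

numMono≡monochromatic : ∀ {n k} (G : Graph n) (c : Coloring n k) →
                        numMono G c ≡ monochromatic (lookup (edges G)) c
numMono≡monochromatic G c = length-filter≡∑𝟙 _ (edges G)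

numMono-proper : ∀ {n k} (G : Graph n) {c : Coloring n k} → IsProper G c → numMono G c ≡ 0
numMono-proper {n} G {c} proper =
  cong length (filter-none (λ p → c (proj₁ p) ≟ c (proj₂ p)) {xs = edges G}
    (All.tabulate λ e∈E → proper _ _ (proj₂ (∈-filter⁻ isEdge? {xs = pairs n} e∈E))))
  where
  isEdge? : Decidable (λ p → adj G (proj₁ p) (proj₂ p) ≡ true)
  isEdge? p = adj G (proj₁ p) (proj₂ p) ≟ᵇ true

lemma7 : (t : ℕ) → 2 ≤ t → {n : ℕ} → (G : Graph n) →
         Σ (Coloring n t) (λ c → IsProper G c) →
         (t′ : ℕ) → 1 ≤ t′ → t′ ≤ t →
         Σ (Coloring n t′) (λ c′ → numMono G c′ * (t * t′) ≤ numEdges G * (2 * (t ∸ t′)))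
lemma7 t _ {n} G (c , proper) t′ 1≤t′ t′≤t =
  let c′ , bound = descended in
  c′ , subst (λ M → M * (t * t′) ≤ numEdges G * (2 * (t ∸ t′))) (sym (numMono≡monochromatic G c′)) bound
  where
  edge : Fin (numEdges G) → Fin n × Fin n
  edge = lookup (edges G)
  start : BoundedColouring edge t t
  start = c , subst (λ M → M * (t * t) ≤ numEdges G * (2 * (t ∸ t)))
                    (trans (sym (numMono-proper G proper)) (numMono≡monochromatic G c)) z≤n
  descended : BoundedColouring edge t t′
  descended = boundedColouring-descend edge t (t ∸ t′) 1≤t′ (≤-reflexive (m∸n+n≡m t′≤t))
                (subst (BoundedColouring edge t) (sym (m∸n+n≡m t′≤t)) start)
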